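{- For positive integers $n$, let $F_n(t)=\sum_{k=0}^n f_{n,k}t^k$ and $G_n(t)=\sum_{k=0}^n g_{n,k}t^k$ be polynomials with $f_{n,k},g_{n,k}\ge 0$ for all $k$ and $F_n(1)>0$, $G_n(1)>0$. Let $X_f^n$ (resp. $X_g^n$) be the random variable taking the value $k$ with probability $f_{n,k}/F_n(1)$ (resp. $g_{n,k}/G_n(1)$). Suppose there are polynomials $H_n(t)$, a nonzero real number $\lambda$ and positive integers $\ell_n$ such that $$F_n(t)=\lambda G_n(t)\pm(1-t)^{\ell_n}H_n(t).$$ Then for every $r<\ell_n$, the $r$-th moment of $X_f^n$ equals the $r$-th moment of $X_g^n$. -}

module Defs where

open import Level using (Level; _⊔_) renaming (suc to lsuc)
open import Data.Nat using (ℕ; zero; suc)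
open import Data.Bool using (Bool; true; false)
open import Data.List using (List; []; _∷_)
open import Relation.Nullary using (¬_)
open import Relation.Binary.Structures using (IsTotalOrder)
open import Algebra.Bundles using (CommutativeRing)

-- An ordered field (the reals ℝ are the intended instance; agda-stdlib has no ℝ).
-- The multiplicative inverse is total, with the convention 0⁻¹ = 0; it is only
-- ever applied below to quantities assumed to be strictly positive.
record OrderedField (c ℓ₁ ℓ₂ : Level) : Set (lsuc (c ⊔ ℓ₁ ⊔ ℓ₂)) where
  field
    commutativeRing : CommutativeRing c ℓ₁
  open CommutativeRing commutativeRing public
  field
    _≤_           : Carrier → Carrier → Set ℓ₂
    isTotalOrder  : IsTotalOrder _≈_ _≤_
    +-mono-≤      : ∀ {x y} z → x ≤ y → (x + z) ≤ (y + z)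
    *-nonneg      : ∀ {x y} → 0# ≤ x → 0# ≤ y → 0# ≤ (x * y)
    0≉1           : ¬ (0# ≈ 1#)
    _⁻¹           : Carrier → Carrier
    inverseʳ      : ∀ x → ¬ (x ≈ 0#) → (x * (x ⁻¹)) ≈ 1#
    0⁻¹≈0         : (0# ⁻¹) ≈ 0#

  infix 4 _<_
  _<_ : Carrier → Carrier → Set (ℓ₁ ⊔ ℓ₂)
  x < y = (x ≤ y) × ¬ (x ≈ y)
    where open import Data.Product using (_×_)

module PolyDefs {c ℓ₁ ℓ₂} (K : OrderedField c ℓ₁ ℓ₂) where
  open OrderedField K

  fromℕ : ℕ → Carrier
  fromℕ zero    = 0#
  fromℕ (suc m) = 1# + fromℕ m

  pow : Carrier → ℕ → Carrier
  pow x zero    = 1#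
  pow x (suc m) = x * pow x m

  sumTo : ℕ → (ℕ → Carrier) → Carrier
  sumTo zero    a = a 0
  sumTo (suc n) a = sumTo n a + a (suc n)

  evalFin : ℕ → (ℕ → Carrier) → Carrier → Carrier
  evalFin n a t = sumTo n (λ k → a k * pow t k)

  evalList : List Carrier → Carrier → Carrier
  evalList []       t = 0#
  evalList (h ∷ hs) t = h + t * evalList hs t

  -- P(X = k) for the random variable X taking value k with probability a_k / A(1),
  -- where A(t) = Σ_{k=0}^{n} a_k t^k
  prob : ℕ → (ℕ → Carrier) → ℕ → Carrier
  prob n a k = a k * (evalFin n a 1# ⁻¹)

  -- r-th moment E[X^r] = Σ_{k=0}^{n} k^r P(X = k)   (with 0^0 = 1)
  moment : ℕ → (ℕ → Carrier) → ℕ → Carrier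
  moment n a r = sumTo n (λ k → pow (fromℕ k) r * prob n a k)

  signed : Bool → Carrier → Carrier
  signed true  x = x
  signed false x = - x

-- Pair a coefficient list c with a weight sequence w via Σₖ wₖ cₖ. Summation by parts gives
-- Σₖ wₖ [(1 - X) c]ₖ = - Σₖ (Δw)ₖ cₖ, so the pairing kills (1 - X)^ℓ H as soon as Δ^ℓ w = 0,
-- e.g. for wₖ = k^r with r < ℓ and for wₖ = 1. A polynomial over an ordered field vanishing at
-- infinitely many points has zero coefficients, so the identity F = λ G ± (1 - t)^ℓ H holds
-- coefficientwise; pairing it with these weights gives Σ k^r f_k = λ Σ k^r g_k and F(1) = λ G(1),
-- and the ratios, i.e. the r-th moments, agree.
module Submission where

open import Defs
open import Level using (Level)
open import Data.Nat as ℕ using (ℕ; zero; suc; z≤n; s≤s) renaming (_≤_ to _≤ℕ_; _<_ to _<ℕ_)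
import Data.Nat.Properties as ℕₚ
open import Data.Integer as ℤ using (ℤ; +_; -[1+_]; _⊖_)
import Data.Integer.Properties as ℤₚ
import Data.Sign as Sign
open Sign using (Sign)
open import Data.Bool using (Bool; true; false)
open import Data.List using (List; []; _∷_; length; map; applyUpTo)
open import Data.List.Relation.Unary.All using (All; []; _∷_)
open import Data.Maybe using (Maybe; just; nothing)
open import Data.Product using (proj₂)
open import Data.Sum using (inj₁; inj₂)
open import Function using (_∘_)
open import Relation.Nullary using (¬_; yes; no)
import Relation.Binary.PropositionalEquality as ≡
open ≡ using (_≡_)
import Relation.Binary.Structures as Structures
import Algebra.Properties.Ring as RingProperties
open import Algebra.Solver.Ring.AlmostCommutativeRing using (_-Raw-AlmostCommutative⟶_; fromCommutativeRing)

-- The ring solver needs coefficients with decidable equality, so it runs over ℤ mapped into K.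
-- Using the multiple n × 1# with 1 × x = x makes con (+ 0) and con (+ 1) denote 0# and 1# on the nose.
module IntegerCoefficientSolver {c ℓ₁ ℓ₂ : Level} (K : OrderedField c ℓ₁ ℓ₂) where
  open OrderedField K hiding (zero)
  open RingProperties ring
    using (-‿distribˡ-*; -‿distribʳ-*; -‿involutive; -0#≈0#; -‿anti-homo-+; -‿+-comm; xyx⁻¹≈y)
  open import Algebra.Properties.Semiring.Mult.TCOptimised semiring using (_×_; 1+×; ×-homo-+; ×1-homo-*)
  open import Relation.Binary.Reasoning.Setoid setoid

  applySign : Sign → Carrier → Carrier
  applySign Sign.+ x = x
  applySign Sign.- x = - x

  applySign-cong : ∀ s {x y} → x ≈ y → applySign s x ≈ applySign s y
  applySign-cong Sign.+ x≈y = x≈y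
  applySign-cong Sign.- x≈y = -‿cong x≈y

  applySign-* : ∀ s t x y → applySign (s Sign.* t) (x * y) ≈ applySign s x * applySign t y
  applySign-* Sign.+ Sign.+ x y = refl
  applySign-* Sign.+ Sign.- x y = -‿distribʳ-* x y
  applySign-* Sign.- Sign.+ x y = -‿distribˡ-* x y
  applySign-* Sign.- Sign.- x y =
    trans (sym (-‿involutive _)) (trans (-‿cong (-‿distribˡ-* x y)) (-‿distribʳ-* _ _))

  x-y≈[z+x]-[z+y] : ∀ x y z → x - y ≈ (z + x) - (z + y)
  x-y≈[z+x]-[z+y] x y z = sym (begin
    (z + x) - (z + y)    ≈⟨ +-congˡ (-‿anti-homo-+ z y) ⟩
    (z + x) + (- y - z)  ≈⟨ sym (+-assoc _ _ _) ⟩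
    (z + x) - y - z      ≈⟨ +-congʳ (+-assoc z x (- y)) ⟩
    z + (x - y) - z      ≈⟨ xyx⁻¹≈y z (x - y) ⟩
    x - y                ∎)

  fromℤ : ℤ → Carrier
  fromℤ (+ n)    = n × 1#
  fromℤ -[1+ n ] = - (suc n × 1#)

  fromℤ-◃ : ∀ s n → fromℤ (s ℤ.◃ n) ≈ applySign s (n × 1#)
  fromℤ-◃ Sign.+ zero    = refl
  fromℤ-◃ Sign.- zero    = sym -0#≈0#
  fromℤ-◃ Sign.+ (suc n) = refl
  fromℤ-◃ Sign.- (suc n) = refl

  fromℤ-signAbs : ∀ i → fromℤ i ≈ applySign (ℤ.sign i) (ℤ.∣ i ∣ × 1#)
  fromℤ-signAbs (+ n)    = refl
  fromℤ-signAbs -[1+ n ] = refl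

  fromℤ-⊖ : ∀ m n → fromℤ (m ⊖ n) ≈ m × 1# - n × 1#
  fromℤ-⊖ zero    zero    = sym (trans (+-congˡ -0#≈0#) (+-identityʳ _))
  fromℤ-⊖ zero    (suc n) = sym (+-identityˡ _)
  fromℤ-⊖ (suc m) zero    = sym (trans (+-congˡ -0#≈0#) (+-identityʳ _))
  fromℤ-⊖ (suc m) (suc n) = begin
    fromℤ (suc m ⊖ suc n)                ≡⟨ ≡.cong fromℤ (ℤₚ.[1+m]⊖[1+n]≡m⊖n m n) ⟩
    fromℤ (m ⊖ n)                        ≈⟨ fromℤ-⊖ m n ⟩
    m × 1# - n × 1#                      ≈⟨ x-y≈[z+x]-[z+y] _ _ 1# ⟩
    (1# + m × 1#) - (1# + n × 1#)        ≈⟨ sym (+-cong (1+× m 1#) (-‿cong (1+× n 1#))) ⟩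
    suc m × 1# - suc n × 1#              ∎

  fromℤ-+ : ∀ i j → fromℤ (i ℤ.+ j) ≈ fromℤ i + fromℤ j
  fromℤ-+ -[1+ m ] -[1+ n ] = begin
    - (suc (suc (m ℕ.+ n)) × 1#)          ≡⟨ ≡.cong (λ k → - (suc k × 1#)) (≡.sym (ℕₚ.+-suc m n)) ⟩
    - ((suc m ℕ.+ suc n) × 1#)            ≈⟨ -‿cong (×-homo-+ 1# (suc m) (suc n)) ⟩
    - (suc m × 1# + suc n × 1#)           ≈⟨ sym (-‿+-comm _ _) ⟩
    - (suc m × 1#) + - (suc n × 1#)       ∎
  fromℤ-+ -[1+ m ] (+ n)    = trans (fromℤ-⊖ n (suc m)) (+-comm _ _)
  fromℤ-+ (+ m)    -[1+ n ] = fromℤ-⊖ m (suc n)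
  fromℤ-+ (+ m)    (+ n)    = ×-homo-+ 1# m n

  fromℤ-* : ∀ i j → fromℤ (i ℤ.* j) ≈ fromℤ i * fromℤ j
  fromℤ-* i j = begin
    fromℤ (i ℤ.* j)                               ≈⟨ fromℤ-◃ (s Sign.* t) (∣i∣ ℕ.* ∣j∣) ⟩
    applySign (s Sign.* t) ((∣i∣ ℕ.* ∣j∣) × 1#)    ≈⟨ applySign-cong (s Sign.* t) (×1-homo-* ∣i∣ ∣j∣) ⟩
    applySign (s Sign.* t) (∣i∣ × 1# * ∣j∣ × 1#)   ≈⟨ applySign-* s t _ _ ⟩
    applySign s (∣i∣ × 1#) * applySign t (∣j∣ × 1#) ≈⟨ sym (*-cong (fromℤ-signAbs i) (fromℤ-signAbs j)) ⟩
    fromℤ i * fromℤ j                             ∎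
    where
    s = ℤ.sign i
    t = ℤ.sign j
    ∣i∣ = ℤ.∣ i ∣
    ∣j∣ = ℤ.∣ j ∣

  fromℤ-neg : ∀ i → fromℤ (ℤ.- i) ≈ - fromℤ i
  fromℤ-neg (+ zero)  = sym -0#≈0#
  fromℤ-neg (+ suc n) = refl
  fromℤ-neg -[1+ n ]  = sym (-‿involutive _)

  fromℤ-morphism : ℤ.+-*-rawRing -Raw-AlmostCommutative⟶ fromCommutativeRing commutativeRing
  fromℤ-morphism = record
    { ⟦_⟧    = fromℤ
    ; +-homo = fromℤ-+
    ; *-homo = fromℤ-*
    ; -‿homo = fromℤ-neg
    ; 0-homo = refl
    ; 1-homo = refl
    }

  fromℤ-≟ : ∀ i j → Maybe (fromℤ i ≈ fromℤ j)
  fromℤ-≟ i j with i ℤ.≟ j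
  ... | yes ≡.refl = just refl
  ... | no _       = nothing

  open import Algebra.Solver.Ring ℤ.+-*-rawRing (fromCommutativeRing commutativeRing) fromℤ-morphism fromℤ-≟ public
    using (solve; _:=_; _:+_; _:*_; :-_; _:-_; con)

module OrderedFieldPolynomials {c ℓ₁ ℓ₂ : Level} (K : OrderedField c ℓ₁ ℓ₂) where
  open OrderedField K hiding (zero)
  open PolyDefs K
  open RingProperties ring using (-1*x≈-x; -‿involutive; -0#≈0#; x∙y⁻¹≈ε⇒x≈y)
  open IntegerCoefficientSolver K using (solve; _:=_; _:+_; _:*_; :-_; _:-_; con)
  open import Relation.Binary.Reasoning.Setoid setoid

  private
    module ≤ = Structures.IsTotalOrder isTotalOrder

  0≤1 : 0# ≤ 1#
  0≤1 with ≤.total 0# 1#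
  ... | inj₁ 0≤1′ = 0≤1′
  ... | inj₂ 1≤0 = ≤.≲-respʳ-≈ (trans (-1*x≈-x (- 1#)) (-‿involutive 1#)) (*-nonneg 0≤-1 0≤-1)
    where
    0≤-1 : 0# ≤ (- 1#)
    0≤-1 = ≤.≲-respʳ-≈ (+-identityˡ _) (≤.≲-respˡ-≈ (-‿inverseʳ 1#) (+-mono-≤ (- 1#) 1≤0))

  x≥0⇒1≤1+x : ∀ {x} → 0# ≤ x → 1# ≤ (1# + x)
  x≥0⇒1≤1+x {x} 0≤x = ≤.≲-respˡ-≈ (+-identityˡ 1#) (≤.≲-respʳ-≈ (+-comm x 1#) (+-mono-≤ 1# 0≤x))

  0≤fromℕ : ∀ j → 0# ≤ fromℕ j
  0≤fromℕ zero    = ≤.refl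
  0≤fromℕ (suc j) = ≤.trans 0≤1 (x≥0⇒1≤1+x (0≤fromℕ j))

  fromℕ-suc≉0 : ∀ j → ¬ (fromℕ (suc j) ≈ 0#)
  fromℕ-suc≉0 j e = 0≉1 (≤.antisym 0≤1 (≤.≲-respʳ-≈ e (x≥0⇒1≤1+x (0≤fromℕ j))))

  >0⇒≉0 : ∀ {x} → 0# < x → ¬ (x ≈ 0#)
  >0⇒≉0 0<x x≈0 = proj₂ 0<x (sym x≈0)

  ≉0∧*≈0⇒≈0 : ∀ {y z} → ¬ (y ≈ 0#) → y * z ≈ 0# → z ≈ 0#
  ≉0∧*≈0⇒≈0 {y} {z} y≉0 yz≈0 = begin
    z               ≈⟨ sym (*-identityˡ z) ⟩
    1# * z          ≈⟨ *-congʳ (sym (inverseʳ y y≉0)) ⟩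
    (y * y ⁻¹) * z  ≈⟨ solve 3 (λ y y⁻¹ z → (y :* y⁻¹) :* z := y⁻¹ :* (y :* z)) refl y (y ⁻¹) z ⟩
    y ⁻¹ * (y * z)  ≈⟨ *-congˡ yz≈0 ⟩
    y ⁻¹ * 0#       ≈⟨ zeroʳ _ ⟩
    0#              ∎

  proportional⇒ratio≈ : ∀ {x y X Y} lam → ¬ (X ≈ 0#) → ¬ (Y ≈ 0#) →
                        x ≈ lam * y → X ≈ lam * Y → x * X ⁻¹ ≈ y * Y ⁻¹
  proportional⇒ratio≈ {x} {y} {X} {Y} lam X≉0 Y≉0 x≈λy X≈λY = begin
    x * X ⁻¹                     ≈⟨ *-congʳ x≈λy ⟩
    lam * y * X ⁻¹               ≈⟨ sym (*-identityʳ _) ⟩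
    lam * y * X ⁻¹ * 1#          ≈⟨ *-congˡ (sym (inverseʳ Y Y≉0)) ⟩
    lam * y * X ⁻¹ * (Y * Y ⁻¹)  ≈⟨ solve 5 (λ l y u Y v → l :* y :* u :* (Y :* v) := y :* v :* (l :* Y :* u))
                                          refl lam y (X ⁻¹) Y (Y ⁻¹) ⟩
    y * Y ⁻¹ * (lam * Y * X ⁻¹)  ≈⟨ *-congˡ (*-congʳ (sym X≈λY)) ⟩
    y * Y ⁻¹ * (X * X ⁻¹)        ≈⟨ *-congˡ (inverseʳ X X≉0) ⟩
    y * Y ⁻¹ * 1#                ≈⟨ *-identityʳ _ ⟩
    y * Y ⁻¹                     ∎

  signed≈signed1* : ∀ s x → signed s x ≈ signed s 1# * x
  signed≈signed1* true  x = sym (*-identityˡ x)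
  signed≈signed1* false x = sym (-1*x≈-x x)

  sumTo-cong : ∀ n {a b} → (∀ k → a k ≈ b k) → sumTo n a ≈ sumTo n b
  sumTo-cong zero    a≈b = a≈b 0
  sumTo-cong (suc n) a≈b = +-cong (sumTo-cong n a≈b) (a≈b (suc n))

  sumTo-suc : ∀ n a → sumTo (suc n) a ≈ a 0 + sumTo n (a ∘ suc)
  sumTo-suc zero    a = refl
  sumTo-suc (suc n) a = trans (+-congʳ (sumTo-suc n a)) (+-assoc _ _ _)

  sumTo-*ʳ : ∀ n a u → sumTo n a * u ≈ sumTo n (λ k → a k * u)
  sumTo-*ʳ zero    a u = refl
  sumTo-*ʳ (suc n) a u = trans (distribʳ u _ _) (+-congʳ (sumTo-*ʳ n a u))

  weightedSum : (ℕ → Carrier) → List Carrier → Carrier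
  weightedSum w []       = 0#
  weightedSum w (x ∷ xs) = w 0 * x + weightedSum (w ∘ suc) xs

  weightedSum-cong : ∀ {v w} xs → (∀ k → v k ≈ w k) → weightedSum v xs ≈ weightedSum w xs
  weightedSum-cong []       v≈w = refl
  weightedSum-cong (x ∷ xs) v≈w = +-cong (*-congʳ (v≈w 0)) (weightedSum-cong xs (v≈w ∘ suc))

  weightedSum-zeroˡ : ∀ {w} xs → (∀ k → w k ≈ 0#) → weightedSum w xs ≈ 0#
  weightedSum-zeroˡ []       w≈0 = refl
  weightedSum-zeroˡ (x ∷ xs) w≈0 =
    trans (+-cong (trans (*-congʳ (w≈0 0)) (zeroˡ x)) (weightedSum-zeroˡ xs (w≈0 ∘ suc))) (+-identityʳ 0#)

  weightedSum-zeroʳ : ∀ w {xs} → All (_≈ 0#) xs → weightedSum w xs ≈ 0#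
  weightedSum-zeroʳ w []           = refl
  weightedSum-zeroʳ w (x≈0 ∷ xs≈0) =
    trans (+-cong (trans (*-congˡ x≈0) (zeroʳ (w 0))) (weightedSum-zeroʳ (w ∘ suc) xs≈0)) (+-identityʳ 0#)

  weightedSum-*ˡ : ∀ a w xs → weightedSum (λ k → a * w k) xs ≈ a * weightedSum w xs
  weightedSum-*ˡ a w []       = sym (zeroʳ a)
  weightedSum-*ˡ a w (x ∷ xs) = begin
    a * w 0 * x + weightedSum (λ k → a * w (suc k)) xs  ≈⟨ +-congˡ (weightedSum-*ˡ a (w ∘ suc) xs) ⟩
    a * w 0 * x + a * weightedSum (w ∘ suc) xs          ≈⟨ solve 4 (λ a b x y → a :* b :* x :+ a :* y := a :* (b :* x :+ y))
                                                                   refl a (w 0) x _ ⟩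
    a * (w 0 * x + weightedSum (w ∘ suc) xs)            ∎

  weightedSum-*ʳ : ∀ a w xs → weightedSum w (map (a *_) xs) ≈ a * weightedSum w xs
  weightedSum-*ʳ a w []       = sym (zeroʳ a)
  weightedSum-*ʳ a w (x ∷ xs) = begin
    w 0 * (a * x) + weightedSum (w ∘ suc) (map (a *_) xs)  ≈⟨ +-congˡ (weightedSum-*ʳ a (w ∘ suc) xs) ⟩
    w 0 * (a * x) + a * weightedSum (w ∘ suc) xs           ≈⟨ solve 4 (λ b a x y → b :* (a :* x) :+ a :* y := a :* (b :* x :+ y))
                                                                      refl (w 0) a x _ ⟩
    a * (w 0 * x + weightedSum (w ∘ suc) xs)               ∎

  infixl 6 _+ₚ_

  _+ₚ_ : List Carrier → List Carrier → List Carrier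
  []       +ₚ ys       = ys
  (x ∷ xs) +ₚ []       = x ∷ xs
  (x ∷ xs) +ₚ (y ∷ ys) = x + y ∷ xs +ₚ ys

  weightedSum-+ₚ : ∀ w xs ys → weightedSum w (xs +ₚ ys) ≈ weightedSum w xs + weightedSum w ys
  weightedSum-+ₚ w []       ys       = sym (+-identityˡ _)
  weightedSum-+ₚ w (x ∷ xs) []       = sym (+-identityʳ _)
  weightedSum-+ₚ w (x ∷ xs) (y ∷ ys) = begin
    w 0 * (x + y) + weightedSum (w ∘ suc) (xs +ₚ ys)
      ≈⟨ +-congˡ (weightedSum-+ₚ (w ∘ suc) xs ys) ⟩
    w 0 * (x + y) + (weightedSum (w ∘ suc) xs + weightedSum (w ∘ suc) ys)
      ≈⟨ solve 5 (λ a x y b c → a :* (x :+ y) :+ (b :+ c) := (a :* x :+ b) :+ (a :* y :+ c)) refl (w 0) x y _ _ ⟩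
    (w 0 * x + weightedSum (w ∘ suc) xs) + (w 0 * y + weightedSum (w ∘ suc) ys)
      ∎

  evalList≈weightedSum : ∀ xs t → evalList xs t ≈ weightedSum (pow t) xs
  evalList≈weightedSum []       t = refl
  evalList≈weightedSum (x ∷ xs) t =
    +-cong (sym (*-identityˡ x)) (trans (*-congˡ (evalList≈weightedSum xs t)) (sym (weightedSum-*ˡ t (pow t) xs)))

  evalList-cong : ∀ xs {t u} → t ≈ u → evalList xs t ≈ evalList xs u
  evalList-cong []       t≈u = refl
  evalList-cong (x ∷ xs) t≈u = +-congˡ (*-cong t≈u (evalList-cong xs t≈u))

  coefficients : ℕ → (ℕ → Carrier) → List Carrier
  coefficients n a = applyUpTo a (suc n)

  weightedSum-coefficients : ∀ w n a → weightedSum w (coefficients n a) ≈ sumTo n (λ k → w k * a k)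
  weightedSum-coefficients w zero    a = +-identityʳ _
  weightedSum-coefficients w (suc n) a =
    trans (+-congˡ (weightedSum-coefficients (w ∘ suc) n (a ∘ suc))) (sym (sumTo-suc n _))

  evalFin≈evalList : ∀ n a t → evalFin n a t ≈ evalList (coefficients n a) t
  evalFin≈evalList n a t = sym (begin
    evalList (coefficients n a) t           ≈⟨ evalList≈weightedSum (coefficients n a) t ⟩
    weightedSum (pow t) (coefficients n a)  ≈⟨ weightedSum-coefficients (pow t) n a ⟩
    sumTo n (λ k → pow t k * a k)           ≈⟨ sumTo-cong n (λ k → *-comm _ _) ⟩
    evalFin n a t                           ∎)

  moment≈weightedSum : ∀ n a r →
    moment n a r ≈ weightedSum (λ k → pow (fromℕ k) r) (coefficients n a) * evalFin n a 1# ⁻¹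
  moment≈weightedSum n a r = sym (begin
    weightedSum (λ k → pow (fromℕ k) r) (coefficients n a) * evalFin n a 1# ⁻¹
      ≈⟨ *-congʳ (weightedSum-coefficients _ n a) ⟩
    sumTo n (λ k → pow (fromℕ k) r * a k) * evalFin n a 1# ⁻¹
      ≈⟨ sumTo-*ʳ n _ _ ⟩
    sumTo n (λ k → pow (fromℕ k) r * a k * evalFin n a 1# ⁻¹)
      ≈⟨ sumTo-cong n (λ k → *-assoc _ _ _) ⟩
    moment n a r
      ∎)

  Δ : (ℕ → Carrier) → ℕ → Carrier
  Δ w k = w (suc k) - w k

  -- the coefficients of X, X², … in (1 - X) · (p + X · Σᵢ xᵢ Xⁱ)
  differencesFrom : Carrier → List Carrier → List Carrier
  differencesFrom p []       = - p ∷ []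
  differencesFrom p (x ∷ xs) = x - p ∷ differencesFrom x xs

  [1-X]·_ : List Carrier → List Carrier
  [1-X]· xs = differencesFrom 0# xs

  [1-X]^_·_ : ℕ → List Carrier → List Carrier
  [1-X]^ zero  · xs = xs
  [1-X]^ suc m · xs = [1-X]· ([1-X]^ m · xs)

  weightedSum-differencesFrom : ∀ w p xs →
    weightedSum w (differencesFrom p xs) ≈ - (w 0 * p) - weightedSum (Δ w) xs
  weightedSum-differencesFrom w p []       =
    solve 2 (λ a p → a :* (:- p) :+ con (+ 0) := :- (a :* p) :- con (+ 0)) refl (w 0) p
  weightedSum-differencesFrom w p (x ∷ xs) = begin
    w 0 * (x - p) + weightedSum (w ∘ suc) (differencesFrom x xs)
      ≈⟨ +-congˡ (weightedSum-differencesFrom (w ∘ suc) x xs) ⟩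
    w 0 * (x - p) + (- (w 1 * x) - weightedSum (Δ w ∘ suc) xs)
      ≈⟨ solve 5 (λ a b x p y → a :* (x :- p) :+ (:- (b :* x) :- y) := :- (a :* p) :- ((b :- a) :* x :+ y))
               refl (w 0) (w 1) x p _ ⟩
    - (w 0 * p) - (Δ w 0 * x + weightedSum (Δ w ∘ suc) xs)
      ∎

  weightedSum-[1-X]· : ∀ w xs → weightedSum w ([1-X]· xs) ≈ - weightedSum (Δ w) xs
  weightedSum-[1-X]· w xs =
    trans (weightedSum-differencesFrom w 0# xs) (solve 2 (λ a y → :- (a :* con (+ 0)) :- y := :- y) refl (w 0) _)

  evalList-[1-X]· : ∀ xs t → evalList ([1-X]· xs) t ≈ (1# - t) * evalList xs t
  evalList-[1-X]· xs t = begin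
    evalList ([1-X]· xs) t                       ≈⟨ evalList≈weightedSum ([1-X]· xs) t ⟩
    weightedSum (pow t) ([1-X]· xs)              ≈⟨ weightedSum-[1-X]· (pow t) xs ⟩
    - weightedSum (Δ (pow t)) xs                 ≈⟨ -‿cong (weightedSum-cong xs Δ-pow) ⟩
    - weightedSum (λ k → (t - 1#) * pow t k) xs  ≈⟨ -‿cong (weightedSum-*ˡ (t - 1#) (pow t) xs) ⟩
    - ((t - 1#) * weightedSum (pow t) xs)        ≈⟨ -‿cong (*-congˡ (sym (evalList≈weightedSum xs t))) ⟩
    - ((t - 1#) * evalList xs t)                 ≈⟨ solve 2 (λ t e → :- ((t :- con (+ 1)) :* e) := (con (+ 1) :- t) :* e)
                                                          refl t _ ⟩
    (1# - t) * evalList xs t                     ∎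
    where
    Δ-pow : ∀ k → Δ (pow t) k ≈ (t - 1#) * pow t k
    Δ-pow k = solve 2 (λ t p → t :* p :- p := (t :- con (+ 1)) :* p) refl t (pow t k)

  evalList-[1-X]^ : ∀ m xs t → evalList ([1-X]^ m · xs) t ≈ pow (1# - t) m * evalList xs t
  evalList-[1-X]^ zero    xs t = sym (*-identityˡ _)
  evalList-[1-X]^ (suc m) xs t =
    trans (evalList-[1-X]· ([1-X]^ m · xs) t) (trans (*-congˡ (evalList-[1-X]^ m xs t)) (sym (*-assoc _ _ _)))

  DegreeBelow : ℕ → (ℕ → Carrier) → Set ℓ₁
  DegreeBelow zero    w = ∀ k → w k ≈ 0#
  DegreeBelow (suc m) w = DegreeBelow m (Δ w)

  Δ-cong : ∀ {v w} → (∀ k → v k ≈ w k) → ∀ k → Δ v k ≈ Δ w k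
  Δ-cong v≈w k = +-cong (v≈w (suc k)) (-‿cong (v≈w k))

  DegreeBelow-cong : ∀ m {v w} → (∀ k → v k ≈ w k) → DegreeBelow m v → DegreeBelow m w
  DegreeBelow-cong zero    v≈w v≈0 k = trans (sym (v≈w k)) (v≈0 k)
  DegreeBelow-cong (suc m) v≈w dv    = DegreeBelow-cong m (Δ-cong v≈w) dv

  DegreeBelow-suc : ∀ m {w} → DegreeBelow m w → DegreeBelow (suc m) w
  DegreeBelow-suc zero    w≈0 k = trans (Δ-cong w≈0 k) (-‿inverseʳ 0#)
  DegreeBelow-suc (suc m) {w} dw = DegreeBelow-suc m {Δ w} dw

  DegreeBelow-mono : ∀ {m} n w → m ≤ℕ n → DegreeBelow m w → DegreeBelow n w
  DegreeBelow-mono zero    w z≤n       dw = dw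
  DegreeBelow-mono (suc n) w z≤n       dw = DegreeBelow-suc n (DegreeBelow-mono n w z≤n dw)
  DegreeBelow-mono (suc n) w (s≤s m≤n) dw = DegreeBelow-mono n (Δ w) m≤n dw

  DegreeBelow-+ : ∀ m {v w} → DegreeBelow m v → DegreeBelow m w → DegreeBelow m (λ k → v k + w k)
  DegreeBelow-+ zero    v≈0 w≈0 k = trans (+-cong (v≈0 k) (w≈0 k)) (+-identityʳ 0#)
  DegreeBelow-+ (suc m) {v} {w} dv dw = DegreeBelow-cong m Δ-+ (DegreeBelow-+ m dv dw)
    where
    Δ-+ : ∀ k → Δ v k + Δ w k ≈ Δ (λ k → v k + w k) k
    Δ-+ k = solve 4 (λ a b c d → (a :- b) :+ (c :- d) := (a :+ c) :- (b :+ d)) refl (v (suc k)) (v k) (w (suc k)) (w k)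

  DegreeBelow-∘suc : ∀ m {w} → DegreeBelow m w → DegreeBelow m (w ∘ suc)
  DegreeBelow-∘suc zero    w≈0 = w≈0 ∘ suc
  DegreeBelow-∘suc (suc m) {w} dw = DegreeBelow-∘suc m {Δ w} dw

  DegreeBelow-fromℕ* : ∀ m {w} → DegreeBelow m w → DegreeBelow (suc m) (λ k → fromℕ k * w k)
  DegreeBelow-fromℕ* zero    {w} w≈0 k =
    trans (+-cong (*-congˡ (w≈0 (suc k))) (-‿cong (*-congˡ (w≈0 k))))
          (solve 2 (λ a b → a :* con (+ 0) :- b :* con (+ 0) := con (+ 0)) refl _ _)
  DegreeBelow-fromℕ* (suc m) {w} dw =
    DegreeBelow-cong (suc m) Δ-fromℕ* (DegreeBelow-+ (suc m) (DegreeBelow-fromℕ* m dw) (DegreeBelow-∘suc (suc m) dw))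
    where
    Δ-fromℕ* : ∀ k → fromℕ k * Δ w k + w (suc k) ≈ Δ (λ k → fromℕ k * w k) k
    Δ-fromℕ* k = solve 3 (λ a b c → a :* (b :- c) :+ b := (con (+ 1) :+ a) :* b :- a :* c)
                         refl (fromℕ k) (w (suc k)) (w k)

  DegreeBelow-pow : ∀ r → DegreeBelow (suc r) (λ k → pow (fromℕ k) r)
  DegreeBelow-pow zero    k = -‿inverseʳ 1#
  DegreeBelow-pow (suc r)   = DegreeBelow-fromℕ* (suc r) (DegreeBelow-pow r)

  DegreeBelow-1-pow-1# : DegreeBelow 1 (pow 1#)
  DegreeBelow-1-pow-1# k = trans (+-congʳ (*-identityˡ _)) (-‿inverseʳ _)

  weightedSum-[1-X]^ : ∀ m {w} xs → DegreeBelow m w → weightedSum w ([1-X]^ m · xs) ≈ 0#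
  weightedSum-[1-X]^ zero    xs w≈0 = weightedSum-zeroˡ xs w≈0
  weightedSum-[1-X]^ (suc m) {w} xs dw =
    trans (weightedSum-[1-X]· w ([1-X]^ m · xs)) (trans (-‿cong (weightedSum-[1-X]^ m xs dw)) -0#≈0#)

  -- For x ∷ xs, the list tailsAt a xs is the quotient by X - a (synthetic division).
  tailsAt : Carrier → List Carrier → List Carrier
  tailsAt a []       = []
  tailsAt a (x ∷ xs) = evalList (x ∷ xs) a ∷ tailsAt a xs

  length-tailsAt : ∀ a xs → length (tailsAt a xs) ≡ length xs
  length-tailsAt a []       = ≡.refl
  length-tailsAt a (x ∷ xs) = ≡.cong suc (length-tailsAt a xs)

  evalList-divMod : ∀ a x xs t →
    evalList (x ∷ xs) t ≈ (t - a) * evalList (tailsAt a xs) t + evalList (x ∷ xs) a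
  evalList-divMod a x []       t =
    solve 3 (λ x t a → x :+ t :* con (+ 0) := (t :- a) :* con (+ 0) :+ (x :+ a :* con (+ 0))) refl x t a
  evalList-divMod a x (y ∷ ys) t = begin
    x + t * evalList (y ∷ ys) t
      ≈⟨ +-congˡ (*-congˡ (evalList-divMod a y ys t)) ⟩
    x + t * ((t - a) * q + r)
      ≈⟨ solve 5 (λ x t a q r → x :+ t :* ((t :- a) :* q :+ r) := (t :- a) :* (r :+ t :* q) :+ (x :+ a :* r))
               refl x t a q r ⟩
    (t - a) * (r + t * q) + (x + a * r)
      ∎
    where
    q = evalList (tailsAt a ys) t
    r = evalList (y ∷ ys) a

  evalList-zero : ∀ {xs} t → All (_≈ 0#) xs → evalList xs t ≈ 0#
  evalList-zero {xs} t xs≈0 = trans (evalList≈weightedSum xs t) (weightedSum-zeroʳ (pow t) xs≈0)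

  tailsAt-zero⇒zero : ∀ a xs → All (_≈ 0#) (tailsAt a xs) → All (_≈ 0#) xs
  tailsAt-zero⇒zero a []       []               = []
  tailsAt-zero⇒zero a (x ∷ xs) (value≈0 ∷ rest) = x≈0 ∷ xs≈0
    where
    xs≈0 = tailsAt-zero⇒zero a xs rest
    x≈0 : x ≈ 0#
    x≈0 = begin
      x                      ≈⟨ sym (+-identityʳ x) ⟩
      x + 0#                 ≈⟨ +-congˡ (sym (trans (*-congˡ (evalList-zero a xs≈0)) (zeroʳ a))) ⟩
      x + a * evalList xs a  ≈⟨ value≈0 ⟩
      0#                     ∎

  vanishing⇒zero : ∀ n a xs → length xs ≤ℕ n →
                   (∀ j → evalList xs (a + fromℕ j) ≈ 0#) → All (_≈ 0#) xs
  vanishing⇒zero n       a []       _           _      = []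
  vanishing⇒zero (suc n) a (x ∷ xs) (s≤s len≤n) vanish =
    tailsAt-zero⇒zero a (x ∷ xs) (root ∷ vanishing⇒zero n (a + 1#) (tailsAt a xs) len′≤n quotient-vanishes)
    where
    len′≤n = ≡.subst (_≤ℕ n) (≡.sym (length-tailsAt a xs)) len≤n
    root : evalList (x ∷ xs) a ≈ 0#
    root = trans (evalList-cong (x ∷ xs) (sym (+-identityʳ a))) (vanish 0)
    quotient-vanishes : ∀ j → evalList (tailsAt a xs) (a + 1# + fromℕ j) ≈ 0#
    quotient-vanishes j = ≉0∧*≈0⇒≈0 (fromℕ-suc≉0 j ∘ trans (sym t-a≈1+j)) (begin
      (t - a) * q                        ≈⟨ sym (+-identityʳ _) ⟩
      (t - a) * q + 0#                   ≈⟨ +-congˡ (sym root) ⟩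
      (t - a) * q + evalList (x ∷ xs) a  ≈⟨ sym (evalList-divMod a x xs t) ⟩
      evalList (x ∷ xs) t                ≈⟨ evalList-cong (x ∷ xs) (+-assoc a 1# (fromℕ j)) ⟩
      evalList (x ∷ xs) (a + fromℕ (suc j)) ≈⟨ vanish (suc j) ⟩
      0#                                 ∎)
      where
      t = a + 1# + fromℕ j
      q = evalList (tailsAt a xs) t
      t-a≈1+j : t - a ≈ fromℕ (suc j)
      t-a≈1+j = solve 2 (λ a f → a :+ con (+ 1) :+ f :- a := con (+ 1) :+ f) refl a (fromℕ j)

  evalList≗⇒weightedSum≈ : ∀ xs ys → (∀ t → evalList xs t ≈ evalList ys t) →
                            ∀ w → weightedSum w xs ≈ weightedSum w ys
  evalList≗⇒weightedSum≈ xs ys same w = x∙y⁻¹≈ε⇒x≈y _ _ (begin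
    weightedSum w xs - weightedSum w ys  ≈⟨ sym (weightedSum-D w) ⟩
    weightedSum w D                      ≈⟨ weightedSum-zeroʳ w D≈0 ⟩
    0#                                   ∎)
    where
    D = xs +ₚ map (- 1# *_) ys
    weightedSum-D : ∀ v → weightedSum v D ≈ weightedSum v xs - weightedSum v ys
    weightedSum-D v = trans (weightedSum-+ₚ v xs (map (- 1# *_) ys))
                            (+-congˡ (trans (weightedSum-*ʳ (- 1#) v ys) (-1*x≈-x _)))
    D-vanishes : ∀ t → evalList D t ≈ 0#
    D-vanishes t = begin
      evalList D t                                     ≈⟨ evalList≈weightedSum D t ⟩
      weightedSum (pow t) D                            ≈⟨ weightedSum-D (pow t) ⟩
      weightedSum (pow t) xs - weightedSum (pow t) ys  ≈⟨ sym (+-cong (evalList≈weightedSum xs t)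
                                                                     (-‿cong (evalList≈weightedSum ys t))) ⟩
      evalList xs t - evalList ys t                    ≈⟨ +-congʳ (same t) ⟩
      evalList ys t - evalList ys t                    ≈⟨ -‿inverseʳ _ ⟩
      0#                                               ∎
    D≈0 : All (_≈ 0#) D
    D≈0 = vanishing⇒zero (length D) 0# D ℕₚ.≤-refl (λ _ → D-vanishes _)

  weightedSum-proportional : ∀ L xs ys zs lam s →
    (∀ t → evalList xs t ≈ lam * evalList ys t + signed s (pow (1# - t) L * evalList zs t)) →
    ∀ w → DegreeBelow L w → weightedSum w xs ≈ lam * weightedSum w ys
  weightedSum-proportional L xs ys zs lam s identity w degree = begin
    weightedSum w xs                              ≈⟨ evalList≗⇒weightedSum≈ xs rhs xs≗rhs w ⟩
    weightedSum w rhs                             ≈⟨ weightedSum-rhs w ⟩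
    lam * weightedSum w ys + σ * weightedSum w S  ≈⟨ +-congˡ (*-congˡ (weightedSum-[1-X]^ L zs degree)) ⟩
    lam * weightedSum w ys + σ * 0#               ≈⟨ trans (+-congˡ (zeroʳ σ)) (+-identityʳ _) ⟩
    lam * weightedSum w ys                        ∎
    where
    σ = signed s 1#
    S = [1-X]^ L · zs
    rhs = map (lam *_) ys +ₚ map (σ *_) S

    weightedSum-rhs : ∀ v → weightedSum v rhs ≈ lam * weightedSum v ys + σ * weightedSum v S
    weightedSum-rhs v = trans (weightedSum-+ₚ v (map (lam *_) ys) (map (σ *_) S))
                              (+-cong (weightedSum-*ʳ lam v ys) (weightedSum-*ʳ σ v S))

    xs≗rhs : ∀ t → evalList xs t ≈ evalList rhs t
    xs≗rhs t = begin
      evalList xs t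
        ≈⟨ identity t ⟩
      lam * evalList ys t + signed s (pow (1# - t) L * evalList zs t)
        ≈⟨ +-congˡ (signed≈signed1* s _) ⟩
      lam * evalList ys t + σ * (pow (1# - t) L * evalList zs t)
        ≈⟨ +-cong (*-congˡ (evalList≈weightedSum ys t))
                  (*-congˡ (trans (sym (evalList-[1-X]^ L zs t)) (evalList≈weightedSum S t))) ⟩
      lam * weightedSum (pow t) ys + σ * weightedSum (pow t) S
        ≈⟨ sym (weightedSum-rhs (pow t)) ⟩
      weightedSum (pow t) rhs
        ≈⟨ sym (evalList≈weightedSum rhs t) ⟩
      evalList rhs t
        ∎

  moment-cong : ∀ n a b r lam → 0# < evalFin n a 1# → 0# < evalFin n b 1# →
    (∀ w → DegreeBelow (suc r) w → weightedSum w (coefficients n a) ≈ lam * weightedSum w (coefficients n b)) →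
    moment n a r ≈ moment n b r
  moment-cong n a b r lam 0<a1 0<b1 proportional = begin
    moment n a r                                          ≈⟨ moment≈weightedSum n a r ⟩
    weightedSum kʳ (coefficients n a) * evalFin n a 1# ⁻¹  ≈⟨ proportional⇒ratio≈ lam (>0⇒≉0 0<a1) (>0⇒≉0 0<b1)
                                                                (proportional kʳ (DegreeBelow-pow r)) a1≈λb1 ⟩
    weightedSum kʳ (coefficients n b) * evalFin n b 1# ⁻¹  ≈⟨ sym (moment≈weightedSum n b r) ⟩
    moment n b r                                          ∎
    where
    kʳ : ℕ → Carrier
    kʳ k = pow (fromℕ k) r
    evalFin-at-1 : ∀ c → evalFin n c 1# ≈ weightedSum (pow 1#) (coefficients n c)
    evalFin-at-1 c = trans (evalFin≈evalList n c 1#) (evalList≈weightedSum (coefficients n c) 1#)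
    a1≈λb1 : evalFin n a 1# ≈ lam * evalFin n b 1#
    a1≈λb1 = begin
      evalFin n a 1#                                     ≈⟨ evalFin-at-1 a ⟩
      weightedSum (pow 1#) (coefficients n a)            ≈⟨ proportional (pow 1#) pow-1#-DegreeBelow ⟩
      lam * weightedSum (pow 1#) (coefficients n b)      ≈⟨ *-congˡ (sym (evalFin-at-1 b)) ⟩
      lam * evalFin n b 1#                               ∎
      where
      pow-1#-DegreeBelow = DegreeBelow-mono (suc r) (pow 1#) (s≤s z≤n) DegreeBelow-1-pow-1#

lemma2p1 : ∀ {c ℓ₁ ℓ₂ : Level} (K : OrderedField c ℓ₁ ℓ₂) →
    let open OrderedField K in
    let open PolyDefs K in
    (f g : ℕ → ℕ → Carrier) →
    (H : ℕ → List Carrier) →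
    (lam : Carrier) →
    (ℓ : ℕ → ℕ) →
    (sgn : ℕ → Bool) →
    (∀ n k → 1 ≤ℕ n → k ≤ℕ n → 0# ≤ f n k) →
    (∀ n k → 1 ≤ℕ n → k ≤ℕ n → 0# ≤ g n k) →
    (∀ n → 1 ≤ℕ n → 0# < evalFin n (f n) 1#) →
    (∀ n → 1 ≤ℕ n → 0# < evalFin n (g n) 1#) →
    ¬ (lam ≈ 0#) →
    (∀ n → 1 ≤ℕ n → 1 ≤ℕ ℓ n) →
    (∀ n → 1 ≤ℕ n → ∀ t →
      evalFin n (f n) t ≈
        (lam * evalFin n (g n) t) + signed (sgn n) (pow (1# - t) (ℓ n) * evalList (H n) t)) →
    ∀ n → 1 ≤ℕ n → ∀ r → r <ℕ ℓ n → moment n (f n) r ≈ moment n (g n) r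
lemma2p1 K f g H lam ℓ sgn _ _ 0<f1 0<g1 _ _ identity n 1≤n r r<ℓ =
  moment-cong n (f n) (g n) r lam (0<f1 n 1≤n) (0<g1 n 1≤n) λ w degree →
    weightedSum-proportional (ℓ n) (coefficients n (f n)) (coefficients n (g n)) (H n) lam (sgn n) identityₙ
      w (DegreeBelow-mono (ℓ n) w r<ℓ degree)
  where
  open OrderedField K hiding (zero)
  open PolyDefs K
  open OrderedFieldPolynomials K
  identityₙ : ∀ t → evalList (coefficients n (f n)) t ≈
                    lam * evalList (coefficients n (g n)) t + signed (sgn n) (pow (1# - t) (ℓ n) * evalList (H n) t)
  identityₙ t = trans (sym (evalFin≈evalList n (f n) t))
                      (trans (identity n 1≤n t) (+-congʳ (*-congˡ (evalFin≈evalList n (g n) t))))
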